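{- Let $n,k,r$ be positive integers with $r\ge k+1$, and let $T$ be a tree with $k$ edges. Let $\mathcal{H}$ be an $r$-uniform multi-hypergraph containing no Berge copy of $T$, and let $S$ be a $(k-1)$-cluster in $\mathcal{H}$. Then every vertex in the core of $S$ has degree exactly $k-1$ in $\mathcal{H}$; in particular, the core vertices of $S$ are incident only with the hyperedges of $S$.
   Context: A multi-hypergraph may contain repeated hyperedges; it is $r$-uniform if all hyperedges have exactly $r$ vertices. For a graph $G$, a multi-hypergraph contains a Berge copy of $G$ if there are an injection $f_1:V(G)\to V(\mathcal{H})$ and an injection $f_2$ from $E(G)$ into the hyperedges of $\mathcal{H}$ (distinct edges of $G$ going to distinct hyperedges, where parallel copies count as distinct) such that $\{f_1(v_1),f_1(v_2)\}\subseteq f_2(\{v_1,v_2\})$ for every edge $\{v_1,v_2\}$ of $G$. A $(k-1)$-cluster of $\mathcal{H}$ is a set of $k-1$ hyperedges of $\mathcal{H}$ whose common intersection contains at least $k-1$ vertices; this common intersection is the core of the cluster, and the union of the $k-1$ hyperedges is its span. -}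

module Defs where

open import Data.Nat using (ℕ; suc)
open import Data.Fin using (Fin)
open import Data.Fin.Subset using (Subset; _∈_; ∣_∣)
open import Data.Fin.Subset.Properties using (_∈?_)
open import Data.List using (List; length; filter; allFin)
open import Data.Product using (_×_; _,_; proj₁; proj₂; Σ; ∃)
open import Data.Sum using (_⊎_)
open import Relation.Binary.PropositionalEquality using (_≡_; _≢_)
open import Function.Definitions using (Injective)

record Graph (t k : ℕ) : Set where
  field
    edge      : Fin k → Fin t × Fin t
    loopless  : ∀ i → proj₁ (edge i) ≢ proj₂ (edge i)
    -- distinct indices give distinct unordered pairs (no parallel edges)
    simple    : ∀ i j → (proj₁ (edge i) ≡ proj₁ (edge j) × proj₂ (edge i) ≡ proj₂ (edge j))
                        ⊎ (proj₁ (edge i) ≡ proj₂ (edge j) × proj₂ (edge i) ≡ proj₁ (edge j))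
                      → i ≡ j
open Graph public

Adj : ∀ {t k} → Graph t k → Fin t → Fin t → Set
Adj {k = k} G u v = Σ (Fin k) λ i →
  (proj₁ (edge G i) ≡ u × proj₂ (edge G i) ≡ v) ⊎ (proj₁ (edge G i) ≡ v × proj₂ (edge G i) ≡ u)

data Walk {t k} (G : Graph t k) : Fin t → Fin t → Set where
  here : ∀ {u} → Walk G u u
  step : ∀ {u v w} → Adj G u v → Walk G v w → Walk G u w

Connected : ∀ {t k} → Graph t k → Set
Connected G = ∀ u v → Walk G u v

IsTree : ∀ {t k} → Graph t k → Set
IsTree {t} {k} G = (t ≡ suc k) × Connected G

-- A multi-hypergraph on vertex set Fin N with m hyperedges (indexed by Fin m;
-- repeated hyperedges allowed since different indices may give equal sets).
MultiHypergraph : ℕ → ℕ → Set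
MultiHypergraph N m = Fin m → Subset N

Uniform : ∀ {N m} → ℕ → MultiHypergraph N m → Set
Uniform r H = ∀ e → ∣ H e ∣ ≡ r

BergeCopy : ∀ {t k N m} → Graph t k → MultiHypergraph N m → Set
BergeCopy {t} {k} {N} {m} G H =
  Σ (Fin t → Fin N) λ f₁ → Σ (Fin k → Fin m) λ f₂ →
    Injective _≡_ _≡_ f₁ × Injective _≡_ _≡_ f₂ ×
    (∀ i → f₁ (proj₁ (edge G i)) ∈ H (f₂ i) × f₁ (proj₂ (edge G i)) ∈ H (f₂ i))

InCore : ∀ {N m c} → MultiHypergraph N m → (Fin c → Fin m) → Fin N → Set
InCore H g x = ∀ i → x ∈ H (g i)

IsCluster : ∀ {N m} (c : ℕ) → MultiHypergraph N m → (Fin c → Fin m) → Set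
IsCluster {N} c H g =
  Injective _≡_ _≡_ g ×
  Σ (Fin c → Fin N) λ h → Injective _≡_ _≡_ h × (∀ j → InCore H g (h j))

degree : ∀ {N m} → MultiHypergraph N m → Fin N → ℕ
degree {m = m} H x = length (filter (λ e → x ∈? H e) (allFin m))

-- Let x be a core vertex and e a hyperedge through x outside the cluster.
-- For k = 1 the tree is one edge, mapped onto e together with x and a second
-- vertex of e.  For k ≥ 2 the tree has two leaves b, v with distinct pendant
-- edges ib, iv (handshake lemma).  Send ib to e, the other k-1 edges
-- bijectively to the cluster edges, the k-1 non-leaf vertices injectively into
-- the core (the other end of ib going to x), b to a fresh vertex of e and v to a
-- fresh vertex of the cluster edge assigned to iv; since r ≥ k+1 fresh vertices
-- exist.  This is a Berge copy of T.  Hence every hyperedge through x belongs to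
-- the cluster, and counting these hyperedges gives degree x = k-1.
module Submission where

open import Defs
open import Data.Nat using (ℕ; zero; suc; _≤_; _<_; _∸_; _+_; _*_; z≤n; s≤s)
  renaming (_≟_ to _≟ℕ_)
open import Data.Nat.Properties
  using (≤-refl; ≤-trans; ≤-reflexive; +-mono-≤; +-cancelˡ-≤; +-comm; n≤1+n;
         *-identityʳ; *-zeroʳ; <⇒≢; ≤-pred; module ≤-Reasoning; +-0-commutativeMonoid)
open import Data.Fin using (Fin; zero; suc; _≟_; punchIn; punchOut)
open import Data.Fin.Properties
  using (any?; punchIn-punchOut; punchInᵢ≢i; punchIn-injective; punchOut-injective)
open import Data.Fin.Subset using (Subset; _∈_; _∉_; ∣_∣; _-_; inside; outside)
open import Data.Fin.Subset.Properties
  using (_∈?_; nonempty?; Empty-unique; ∣⊥∣≡0; p─⊥≡p; p─q⊆p)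
open import Data.Vec using (_∷_; there)
open import Data.Vec.Functional as Vector using (Vector; insertAt; removeAt)
open import Data.Vec.Functional.Properties using (insertAt-lookup; insertAt-punchIn)
open import Data.List using (length; filter; tabulate)
open import Data.Product using (_×_; _,_; proj₁; proj₂; Σ; ∃)
open import Data.Sum using (_⊎_; inj₁; inj₂; [_,_])
open import Function using (_∘_)
open import Function.Definitions using (Injective)
open import Relation.Nullary using (¬_; Dec; yes; no; contradiction; _⊎-dec_; _×-dec_; ¬?)
open import Relation.Unary using (Decidable)
open import Relation.Binary.PropositionalEquality
  using (_≡_; _≢_; refl; sym; trans; cong; cong₂; subst; subst₂; module ≡-Reasoning)
open import Algebra.Properties.CommutativeMonoid.Sum +-0-commutativeMonoid
  using (sum; sum-syntax; ∑-comm; ∑-distrib-+; sum-cong-≗)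

𝟙 : {P : Set} → Dec P → ℕ
𝟙 (yes _) = 1
𝟙 (no _)  = 0

count : ∀ {n} {P : Fin n → Set} → Decidable P → ℕ
count {n} P? = ∑[ i < n ] 𝟙 (P? i)

𝟙-cong : {P Q : Set} → (P → Q) → (Q → P) → (p : Dec P) (q : Dec Q) → 𝟙 p ≡ 𝟙 q
𝟙-cong _   _   (yes _) (yes _) = refl
𝟙-cong P⇒Q _   (yes p) (no ¬q) = contradiction (P⇒Q p) ¬q
𝟙-cong _   Q⇒P (no ¬p) (yes q) = contradiction (Q⇒P q) ¬p
𝟙-cong _   _   (no _)  (no _)  = refl

𝟙-mono : {P Q : Set} → (P → Q) → (p : Dec P) (q : Dec Q) → 𝟙 p ≤ 𝟙 q
𝟙-mono _   (yes _) (yes _) = ≤-refl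
𝟙-mono P⇒Q (yes p) (no ¬q) = contradiction (P⇒Q p) ¬q
𝟙-mono _   (no _)  _       = z≤n

𝟙-⊎ : {P Q : Set} → ¬ (P × Q) → (p : Dec P) (q : Dec Q) → 𝟙 (p ⊎-dec q) ≡ 𝟙 p + 𝟙 q
𝟙-⊎ disjoint (yes p) (yes q) = contradiction (p , q) disjoint
𝟙-⊎ _        (yes _) (no _)  = refl
𝟙-⊎ _        (no _)  (yes _) = refl
𝟙-⊎ _        (no _)  (no _)  = refl

sum-mono : ∀ {n} {f g : Vector ℕ n} → (∀ i → f i ≤ g i) → sum f ≤ sum g
sum-mono {zero}  _   = z≤n
sum-mono {suc n} f≤g = +-mono-≤ (f≤g zero) (sum-mono (f≤g ∘ suc))

sum-const : ∀ n c → ∑[ i < n ] c ≡ n * c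
sum-const zero    c = refl
sum-const (suc n) c = cong (c +_) (sum-const n c)

module _ {n : ℕ} {P : Fin n → Set} (P? : Decidable P) where

  count-cong : {Q : Fin n → Set} (Q? : Decidable Q) → (∀ i → P i → Q i) → (∀ i → Q i → P i) →
               count P? ≡ count Q?
  count-cong Q? P⇒Q Q⇒P = sum-cong-≗ (λ i → 𝟙-cong (P⇒Q i) (Q⇒P i) (P? i) (Q? i))

  count-mono : {Q : Fin n → Set} (Q? : Decidable Q) → (∀ i → P i → Q i) → count P? ≤ count Q?
  count-mono Q? P⇒Q = sum-mono (λ i → 𝟙-mono (P⇒Q i) (P? i) (Q? i))

  count-none : (∀ i → ¬ P i) → count P? ≡ 0
  count-none ¬P = begin
    count P?        ≡⟨ sum-cong-≗ (λ i → 𝟙-cong (¬P i) (λ ()) (P? i) (no λ ())) ⟩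
    ∑[ i < n ] 0    ≡⟨ sum-const n 0 ⟩
    n * 0           ≡⟨ *-zeroʳ n ⟩
    0               ∎
    where open ≡-Reasoning

count-witness : ∀ {n} {P : Fin n → Set} (P? : Decidable P) → 1 ≤ count P? → ∃ P
count-witness {suc n} P? pos with P? zero
... | yes p = zero , p
... | no _  = let (i , p) = count-witness (P? ∘ suc) pos in suc i , p

count-point : ∀ {n} (w : Fin n) → count (w ≟_) ≡ 1
count-point {suc n} zero    = cong suc (count-none (λ (i : Fin n) → zero ≟ suc i) (λ i ()))
count-point {suc n} (suc w) = trans (count-cong ((suc w ≟_) ∘ suc) (w ≟_) (λ _ → suc-inj) (λ _ → cong suc))
                                    (count-point w)
  where suc-inj : ∀ {i j : Fin n} → suc i ≡ suc j → i ≡ j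
        suc-inj refl = refl

count-pos : ∀ {n} {P : Fin n → Set} (P? : Decidable P) {i} → P i → 1 ≤ count P?
count-pos P? {i} p = subst (_≤ count P?) (count-point i)
                           (count-mono (i ≟_) P? (λ j i≡j → subst _ i≡j p))

count-pair : ∀ {n} {i j : Fin n} → i ≢ j → count (λ z → (i ≟ z) ⊎-dec (j ≟ z)) ≡ 2
count-pair {n} {i} {j} i≢j = begin
  count (λ z → (i ≟ z) ⊎-dec (j ≟ z))
    ≡⟨ sum-cong-≗ (λ z → 𝟙-⊎ (λ (i≡z , j≡z) → i≢j (trans i≡z (sym j≡z))) (i ≟ z) (j ≟ z)) ⟩
  ∑[ z < n ] (𝟙 (i ≟ z) + 𝟙 (j ≟ z))
    ≡⟨ ∑-distrib-+ (λ z → 𝟙 (i ≟ z)) (λ z → 𝟙 (j ≟ z)) ⟩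
  count (i ≟_) + count (j ≟_)
    ≡⟨ cong₂ _+_ (count-point i) (count-point j) ⟩
  2 ∎
  where open ≡-Reasoning

count-unique : ∀ {n} {P : Fin n → Set} (P? : Decidable P) → count P? ≤ 1 →
               ∀ {i j} → P i → P j → i ≡ j
count-unique P? at-most-one {i} {j} p q with i ≟ j
... | yes i≡j = i≡j
... | no  i≢j = contradiction (≤-trans two≤count at-most-one) λ { (s≤s ()) }
  where
  two≤count : 2 ≤ count P?
  two≤count = subst (_≤ count P?) (count-pair i≢j)
    (count-mono _ P? λ { z (inj₁ refl) → p ; z (inj₂ refl) → q })

count-two : ∀ {n} {P : Fin n → Set} (P? : Decidable P) → 2 ≤ count P? →
            Σ (Fin n) λ i → Σ (Fin n) λ j → i ≢ j × P i × P j
count-two {P = P} P? two≤count with count-witness P? (≤-trans (s≤s z≤n) two≤count)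
... | i , p with any? (λ j → P? j ×-dec ¬? (i ≟ j))
...   | yes (j , q , i≢j) = i , j , i≢j , p , q
...   | no  none = contradiction (≤-trans two≤count at-most-one) λ { (s≤s ()) }
  where
  only-i : ∀ j → P j → i ≡ j
  only-i j q with i ≟ j
  ... | yes i≡j = i≡j
  ... | no  i≢j = contradiction (j , q , i≢j) none
  at-most-one : count P? ≤ 1
  at-most-one = subst (count P? ≤_) (count-point i) (count-mono P? (i ≟_) only-i)

length-filter : ∀ {n} {A : Set} {P : A → Set} (P? : Decidable P) (f : Fin n → A) →
                length (filter P? (tabulate f)) ≡ ∑[ i < n ] 𝟙 (P? (f i))
length-filter {zero}  P? f = refl
length-filter {suc n} P? f with P? (f zero)
... | yes _ = cong suc (length-filter P? (f ∘ suc))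
... | no  _ = length-filter P? (f ∘ suc)

count-image : ∀ {c m} (g : Fin c → Fin m) → Injective _≡_ _≡_ g →
              count (λ e → any? (λ i → g i ≟ e)) ≡ c
count-image {c} {m} g g-inj = begin
  count (λ e → any? (λ i → g i ≟ e))   ≡⟨ sum-cong-≗ fibre ⟩
  ∑[ e < m ] ∑[ i < c ] 𝟙 (g i ≟ e)    ≡⟨ ∑-comm (λ e i → 𝟙 (g i ≟ e)) ⟩
  ∑[ i < c ] count (g i ≟_)            ≡⟨ sum-cong-≗ (count-point ∘ g) ⟩
  ∑[ i < c ] 1                         ≡⟨ sum-const c 1 ⟩
  c * 1                                ≡⟨ *-identityʳ c ⟩
  c                                    ∎
  where
  open ≡-Reasoning
  -- each point of the image has exactly one preimage
  fibre : ∀ e → 𝟙 (any? (λ i → g i ≟ e)) ≡ count (λ i → g i ≟ e)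
  fibre e with any? (λ i → g i ≟ e)
  ... | yes (i , gi≡e) = sym (trans (count-cong (λ j → g j ≟ e) (i ≟_)
                                       (λ j gj≡e → g-inj (trans gi≡e (sym gj≡e)))
                                       (λ { j refl → gi≡e }))
                                     (count-point i))
  ... | no  ∄i = sym (count-none (λ i → g i ≟ e) (λ i gi≡e → ∄i (i , gi≡e)))

degree-exact : ∀ {n m c} (H : MultiHypergraph n m) (g : Fin c → Fin m) → Injective _≡_ _≡_ g →
               ∀ {x} → InCore H g x → (∀ e → x ∈ H e → Σ (Fin c) λ i → g i ≡ e) →
               degree H x ≡ c
degree-exact H g g-inj {x} x-core only-g = begin
  degree H x                           ≡⟨ length-filter (λ e → x ∈? H e) (λ e → e) ⟩
  count (λ e → x ∈? H e)               ≡⟨ count-cong (λ e → x ∈? H e) (λ e → any? (λ i → g i ≟ e))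
                                                     only-g (λ { e (i , refl) → x-core i }) ⟩
  count (λ e → any? (λ i → g i ≟ e))   ≡⟨ count-image g g-inj ⟩
  _                                    ∎
  where open ≡-Reasoning

∣p∣≤1+∣p-x∣ : ∀ {n} (p : Subset n) (x : Fin n) → ∣ p ∣ ≤ suc ∣ p - x ∣
∣p∣≤1+∣p-x∣ (inside  ∷ p) zero    = s≤s (≤-reflexive (cong ∣_∣ (sym (p─⊥≡p p))))
∣p∣≤1+∣p-x∣ (outside ∷ p) zero    = ≤-trans (≤-reflexive (cong ∣_∣ (sym (p─⊥≡p p)))) (n≤1+n _)
∣p∣≤1+∣p-x∣ (inside  ∷ p) (suc x) = s≤s (∣p∣≤1+∣p-x∣ p x)
∣p∣≤1+∣p-x∣ (outside ∷ p) (suc x) = ∣p∣≤1+∣p-x∣ p x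

x∉p-x : ∀ {n} (p : Subset n) (x : Fin n) → x ∉ p - x
x∉p-x (_ ∷ p) zero    ()
x∉p-x (_ ∷ p) (suc x) (there x∈p-x) = x∉p-x p x x∈p-x

fresh : ∀ {n p} (S : Subset n) (w : Fin p → Fin n) → p < ∣ S ∣ →
        Σ (Fin n) λ z → z ∈ S × (∀ j → w j ≢ z)
fresh {n} {zero} S w 0<∣S∣ with nonempty? S
... | yes (z , z∈S) = z , z∈S , λ ()
... | no  empty     = contradiction (trans (cong ∣_∣ (Empty-unique empty)) (∣⊥∣≡0 n))
                                    (<⇒≢ 0<∣S∣ ∘ sym)
fresh {p = suc p} S w p<∣S∣ with fresh (S - w zero) (w ∘ suc) (≤-pred (≤-trans p<∣S∣ (∣p∣≤1+∣p-x∣ S (w zero))))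
... | z , z∈S-w₀ , avoids = z , p─q⊆p S _ z∈S-w₀ , λ
  { zero    w₀≡z → x∉p-x S (w zero) (subst (_∈ S - w zero) (sym w₀≡z) z∈S-w₀)
  ; (suc j) → avoids j }

module _ {A : Set} {n : ℕ} (f : Vector A n) (i : Fin (suc n)) (y : A) where

  insertAt-punchOut : ∀ {j} (i≢j : i ≢ j) → insertAt f i y j ≡ f (punchOut i≢j)
  insertAt-punchOut i≢j = trans (cong (insertAt f i y) (sym (punchIn-punchOut i≢j)))
                                (insertAt-punchIn f i y (punchOut i≢j))

  insertAt-view : ∀ j → (i ≡ j × insertAt f i y j ≡ y) ⊎
                        Σ (i ≢ j) λ i≢j → insertAt f i y j ≡ f (punchOut i≢j)
  insertAt-view j with i ≟ j
  ... | yes refl = inj₁ (refl , insertAt-lookup f i y)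
  ... | no  i≢j  = inj₂ (i≢j , insertAt-punchOut i≢j)

  insertAt-all : (P : A → Set) → P y → (∀ j → P (f j)) → ∀ j → P (insertAt f i y j)
  insertAt-all P Py Pf j with insertAt-view j
  ... | inj₁ (_ , eq)   = subst P (sym eq) Py
  ... | inj₂ (_ , eq)   = subst P (sym eq) (Pf _)

  insertAt-injective : Injective _≡_ _≡_ f → (∀ j → f j ≢ y) → Injective _≡_ _≡_ (insertAt f i y)
  insertAt-injective f-inj y-fresh {j} {j′} eq with insertAt-view j | insertAt-view j′
  ... | inj₁ (i≡j , _)    | inj₁ (i≡j′ , _)    = trans (sym i≡j) i≡j′
  ... | inj₁ (_ , at-j)   | inj₂ (_ , at-j′)   = contradiction (trans (sym at-j′) (trans (sym eq) at-j)) (y-fresh _)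
  ... | inj₂ (_ , at-j)   | inj₁ (_ , at-j′)   = contradiction (trans (sym at-j) (trans eq at-j′)) (y-fresh _)
  ... | inj₂ (i≢j , at-j) | inj₂ (i≢j′ , at-j′) =
        punchOut-injective i≢j i≢j′ (f-inj (trans (sym at-j) (trans eq at-j′)))

module _ {n : ℕ} {b v : Fin (suc (suc n))} (b≢v : b ≢ v) where

  interior : ∀ {u} → u ≢ b → u ≢ v → Fin n
  interior u≢b u≢v = punchOut {i = punchOut b≢v} {j = punchOut (u≢b ∘ sym)}
    (λ eq → u≢v (sym (punchOut-injective b≢v (u≢b ∘ sym) eq)))

module _ {A : Set} {n : ℕ} {b v : Fin (suc (suc n))} (b≢v : b ≢ v) where

  extend₂ : Vector A n → A → A → Vector A (suc (suc n))
  extend₂ f y z = insertAt (insertAt f (punchOut b≢v) z) b y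

  module _ (f : Vector A n) (y z : A) where

    extend₂-b : extend₂ f y z b ≡ y
    extend₂-b = insertAt-lookup _ b y

    extend₂-v : extend₂ f y z v ≡ z
    extend₂-v = trans (insertAt-punchOut _ b y b≢v) (insertAt-lookup f (punchOut b≢v) z)

    extend₂-interior : ∀ {u} (u≢b : u ≢ b) (u≢v : u ≢ v) → extend₂ f y z u ≡ f (interior b≢v u≢b u≢v)
    extend₂-interior u≢b u≢v = trans (insertAt-punchOut _ b y (u≢b ∘ sym))
                                     (insertAt-punchOut f (punchOut b≢v) z _)

    extend₂-injective : Injective _≡_ _≡_ f → (∀ j → f j ≢ y) → (∀ j → f j ≢ z) → z ≢ y →
                        Injective _≡_ _≡_ (extend₂ f y z)
    extend₂-injective f-inj y-fresh z-fresh z≢y =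
      insertAt-injective _ b y (insertAt-injective f (punchOut b≢v) z f-inj z-fresh)
                         (insertAt-all f (punchOut b≢v) z (_≢ y) z≢y y-fresh)

-- An injection h into a set Core can be modified to send a prescribed position
-- j₀ to a prescribed point x of Core: remove a slot j₁ whose removal leaves x
-- outside the image (the preimage of x if any), then insert x at j₀.
retarget : ∀ {c N} (Core : Fin N → Set) (h : Fin (suc c) → Fin N) → Injective _≡_ _≡_ h →
           (∀ j → Core (h j)) → ∀ {x} → Core x → (j₀ : Fin (suc c)) →
           Σ (Fin (suc c) → Fin N) λ h′ →
             Injective _≡_ _≡_ h′ × (∀ j → Core (h′ j)) × h′ j₀ ≡ x
retarget {c} Core h h-inj h-core {x} x-core j₀ =
  insertAt (removeAt h j₁) j₀ x ,
  insertAt-injective (removeAt h j₁) j₀ x (punchIn-injective j₁ _ _ ∘ h-inj) x-fresh ,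
  insertAt-all (removeAt h j₁) j₀ x Core x-core (h-core ∘ punchIn j₁) ,
  insertAt-lookup (removeAt h j₁) j₀ x
  where
  spare-slot : Σ (Fin (suc c)) λ j₁ → ∀ j → h (punchIn j₁ j) ≢ x
  spare-slot with any? (λ j → h j ≟ x)
  ... | yes (j₁ , hj₁≡x) = j₁ , λ j eq → punchInᵢ≢i j₁ j (h-inj (trans eq (sym hj₁≡x)))
  ... | no  ∄j          = j₀ , λ j eq → ∄j (punchIn j₀ j , eq)
  j₁ : Fin (suc c)
  j₁ = proj₁ spare-slot
  x-fresh : ∀ j → removeAt h j₁ j ≢ x
  x-fresh = proj₂ spare-slot

module _ {t k : ℕ} (T : Graph t k) where

  end₁ end₂ : Fin k → Fin t
  end₁ i = proj₁ (edge T i)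
  end₂ i = proj₂ (edge T i)

  Incident : Fin t → Fin k → Set
  Incident u i = end₁ i ≡ u ⊎ end₂ i ≡ u

  incident? : ∀ u i → Dec (Incident u i)
  incident? u i = (end₁ i ≟ u) ⊎-dec (end₂ i ≟ u)

  deg : Fin t → ℕ
  deg u = count (incident? u)

  -- every edge has two endpoints, so the degrees sum to twice the number of edges
  handshake : ∑[ u < t ] deg u ≡ k * 2
  handshake = begin
    ∑[ u < t ] deg u
      ≡⟨ sum-cong-≗ (λ u → sum-cong-≗ (λ i → 𝟙-⊎ (no-loop i) (end₁ i ≟ u) (end₂ i ≟ u))) ⟩
    ∑[ u < t ] ∑[ i < k ] (𝟙 (end₁ i ≟ u) + 𝟙 (end₂ i ≟ u))
      ≡⟨ ∑-comm (λ u i → 𝟙 (end₁ i ≟ u) + 𝟙 (end₂ i ≟ u)) ⟩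
    ∑[ i < k ] ∑[ u < t ] (𝟙 (end₁ i ≟ u) + 𝟙 (end₂ i ≟ u))
      ≡⟨ sum-cong-≗ (λ i → trans (∑-distrib-+ (λ u → 𝟙 (end₁ i ≟ u)) (λ u → 𝟙 (end₂ i ≟ u)))
                                 (cong₂ _+_ (count-point (end₁ i)) (count-point (end₂ i)))) ⟩
    ∑[ i < k ] 2
      ≡⟨ sum-const k 2 ⟩
    k * 2 ∎
    where
    open ≡-Reasoning
    no-loop : ∀ i {u} → ¬ (end₁ i ≡ u × end₂ i ≡ u)
    no-loop i (p , q) = loopless T i (trans p (sym q))

  Pendant : Fin t → Fin k → Set
  Pendant b i = Incident b i × (∀ j → Incident b j → j ≡ i)

  degree-one⇒pendant : ∀ {b} → deg b ≡ 1 → Σ (Fin k) (Pendant b)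
  degree-one⇒pendant deg≡1 with count-witness (incident? _) (≤-reflexive (sym deg≡1))
  ... | i , b∈i = i , b∈i , λ j b∈j → count-unique (incident? _) (≤-reflexive deg≡1) b∈j b∈i

  record OtherEnd (u : Fin t) (i : Fin k) : Set where
    field
      vertex   : Fin t
      distinct : vertex ≢ u
      incident : Incident vertex i
      only     : ∀ w → Incident w i → w ≡ u ⊎ w ≡ vertex

  other-end : ∀ {u i} → Incident u i → OtherEnd u i
  other-end {i = i} (inj₁ refl) = record
    { vertex = end₂ i ; distinct = loopless T i ∘ sym ; incident = inj₂ refl
    ; only = λ { w (inj₁ refl) → inj₁ refl ; w (inj₂ refl) → inj₂ refl } }
  other-end {i = i} (inj₂ refl) = record
    { vertex = end₁ i ; distinct = loopless T i ; incident = inj₁ refl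
    ; only = λ { w (inj₁ refl) → inj₂ refl ; w (inj₂ refl) → inj₁ refl } }

  walk-closed : (Q : Fin t → Set) → (∀ {u w} → Adj T u w → Q u → Q w) →
                ∀ {u w} → Walk T u w → Q u → Q w
  walk-closed Q closed here          Qu = Qu
  walk-closed Q closed (step adj wk) Qu = walk-closed Q closed wk (closed adj Qu)

  adj-incident : ∀ {u w} (adj : Adj T u w) → Incident u (proj₁ adj) × Incident w (proj₁ adj)
  adj-incident (i , inj₁ (p , q)) = inj₁ p , inj₂ q
  adj-incident (i , inj₂ (p , q)) = inj₂ q , inj₁ p

walk-incident : ∀ {t k} (T : Graph t k) {u w} → Walk T u w → u ≢ w → Σ (Fin k) (Incident T u)
walk-incident T here         u≢u = contradiction refl u≢u
walk-incident T (step adj _) _   = proj₁ adj , proj₁ (adj-incident T adj)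

connected⇒deg≥1 : ∀ {s k} (T : Graph (suc (suc s)) k) → Connected T → ∀ u → 1 ≤ deg T u
connected⇒deg≥1 T conn u with walk-incident T (conn u (punchIn u zero)) (punchInᵢ≢i u zero ∘ sym)
... | i , u∈i = count-pos (incident? T u) u∈i

-- A connected graph with s + 1 edges on s + 2 vertices has at least two leaves:
-- the degrees are all ≥ 1 and sum to 2(s + 1).
two-leaves : ∀ {s} (T : Graph (suc (suc s)) (suc s)) → Connected T → 2 ≤ count (λ u → deg T u ≟ℕ 1)
two-leaves {s} T conn = +-cancelˡ-≤ (suc s * 2) 2 leaves (begin
  suc s * 2 + 2                               ≡⟨ +-comm (suc s * 2) 2 ⟩
  suc (suc s) * 2                             ≡⟨ sum-const (suc (suc s)) 2 ⟨
  ∑[ u < suc (suc s) ] 2                      ≤⟨ sum-mono (λ u → 2≤d+[d≡1] (connected⇒deg≥1 T conn u)) ⟩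
  ∑[ u < suc (suc s) ] (deg T u + 𝟙 (deg T u ≟ℕ 1))  ≡⟨ ∑-distrib-+ (deg T) (λ u → 𝟙 (deg T u ≟ℕ 1)) ⟩
  ∑[ u < suc (suc s) ] deg T u + leaves       ≡⟨ cong (_+ leaves) (handshake T) ⟩
  suc s * 2 + leaves                          ∎)
  where
  open ≤-Reasoning
  leaves : ℕ
  leaves = count (λ u → deg T u ≟ℕ 1)
  2≤d+[d≡1] : ∀ {d} → 1 ≤ d → 2 ≤ d + 𝟙 (d ≟ℕ 1)
  2≤d+[d≡1] {suc zero}    _ = ≤-refl
  2≤d+[d≡1] {suc (suc d)} _ = s≤s (s≤s z≤n)

third-point : ∀ {s} {b v : Fin (suc (suc (suc s)))} → b ≢ v → Σ (Fin (suc (suc (suc s)))) λ w → w ≢ b × w ≢ v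
third-point {s} {b} {v} b≢v =
  punchIn b (punchIn v′ zero) , punchInᵢ≢i b _ ,
  λ w≡v → punchInᵢ≢i v′ zero (punchIn-injective b _ _ (trans w≡v (sym (punchIn-punchOut b≢v))))
  where
  v′ : Fin (suc (suc s))
  v′ = punchOut b≢v

-- In a connected graph with at least three vertices, two distinct leaves have
-- distinct pendant edges: otherwise the two leaves and their common edge would
-- form a whole connected component.
pendant-edges-differ : ∀ {s k} (T : Graph (suc (suc (suc s))) k) → Connected T →
                       ∀ {b v ib iv} → b ≢ v → Pendant T b ib → Pendant T v iv → ib ≢ iv
pendant-edges-differ T conn {b} {v} {ib} b≢v (b∈ib , only-ib) (v∈iv , only-iv) refl =
  let (w , w≢b , w≢v) = third-point b≢v
  in [ w≢b , w≢v ] (walk-closed T Q closed (conn b w) (inj₁ refl))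
  where
  open OtherEnd (other-end T b∈ib)
  Q : Fin _ → Set
  Q u = u ≡ b ⊎ u ≡ v
  v≡a : v ≡ vertex
  v≡a with only v v∈iv
  ... | inj₁ v≡b = contradiction (sym v≡b) b≢v
  ... | inj₂ v≡a = v≡a
  edge-is-ib : ∀ {u i} → Q u → Incident T u i → i ≡ ib
  edge-is-ib (inj₁ refl) = only-ib _
  edge-is-ib (inj₂ refl) = only-iv _
  closed : ∀ {u w} → Adj T u w → Q u → Q w
  closed adj Qu with adj-incident T adj
  ... | u∈i , w∈i with only _ (subst (Incident T _) (edge-is-ib Qu u∈i) w∈i)
  ...   | inj₁ w≡b = inj₁ w≡b
  ...   | inj₂ w≡a = inj₂ (trans w≡a (sym v≡a))

record LeafPair {t k : ℕ} (T : Graph t k) : Set where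
  field
    leaf₁ leaf₂   : Fin t
    edge₁ edge₂   : Fin k
    leaves-differ : leaf₁ ≢ leaf₂
    pendant₁      : Pendant T leaf₁ edge₁
    pendant₂      : Pendant T leaf₂ edge₂
    edges-differ  : edge₁ ≢ edge₂

leaf-pair : ∀ {s} (T : Graph (suc (suc (suc s))) (suc (suc s))) → Connected T → LeafPair T
leaf-pair T conn = from-leaves (count-two (λ u → deg T u ≟ℕ 1) (two-leaves T conn))
  where
  from-leaves : Σ _ (λ b → Σ _ λ v → b ≢ v × deg T b ≡ 1 × deg T v ≡ 1) → LeafPair T
  from-leaves (b , v , b≢v , deg-b , deg-v) = record
    { leaf₁ = b ; leaf₂ = v ; edge₁ = proj₁ pendant-b ; edge₂ = proj₁ pendant-v
    ; leaves-differ = b≢v ; pendant₁ = proj₂ pendant-b ; pendant₂ = proj₂ pendant-v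
    ; edges-differ = pendant-edges-differ T conn b≢v (proj₂ pendant-b) (proj₂ pendant-v) }
    where
    pendant-b : Σ _ (Pendant T b)
    pendant-b = degree-one⇒pendant T {b} deg-b
    pendant-v : Σ _ (Pendant T v)
    pendant-v = degree-one⇒pendant T {v} deg-v

berge-criterion : ∀ {t k N m} (T : Graph t k) (H : MultiHypergraph N m) {b v a ib iv} →
  Pendant T b ib → Pendant T v iv → (∀ u → Incident T u ib → u ≡ b ⊎ u ≡ a) →
  (f₁ : Fin t → Fin N) (f₂ : Fin k → Fin m) → Injective _≡_ _≡_ f₁ → Injective _≡_ _≡_ f₂ →
  f₁ b ∈ H (f₂ ib) → f₁ a ∈ H (f₂ ib) → f₁ v ∈ H (f₂ iv) →
  (∀ u i → u ≢ b → u ≢ v → ib ≢ i → f₁ u ∈ H (f₂ i)) → BergeCopy T H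
berge-criterion T H {v = v} {ib = ib} (_ , only-ib) (_ , only-iv) ends-ib f₁ f₂ f₁-inj f₂-inj
                b-in a-in v-in interior-in =
  f₁ , f₂ , f₁-inj , f₂-inj , λ i → covered (inj₁ refl) , covered (inj₂ refl)
  where
  covered : ∀ {u i} → Incident T u i → f₁ u ∈ H (f₂ i)
  covered {u} {i} u∈i with ib ≟ i
  ... | yes refl = [ (λ { refl → b-in }) , (λ { refl → a-in }) ] (ends-ib u u∈i)
  ... | no  ib≢i with v ≟ u
  ...   | yes refl = subst (λ j → f₁ v ∈ H (f₂ j)) (sym (only-iv i u∈i)) v-in
  ...   | no  v≢u  = interior-in u i (λ { refl → ib≢i (sym (only-ib i u∈i)) }) (v≢u ∘ sym) ib≢i

single-edge-copy : ∀ {n m r} (T : Graph 2 1) (H : MultiHypergraph n m) → Uniform r H → 2 ≤ r →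
                   ∀ {x e} → x ∈ H e → BergeCopy T H
single-edge-copy T H unif 2≤r {x} {e} x∈e =
  f₁ , (λ _ → e) , f₁-inj , (λ { {zero} {zero} _ → refl }) , λ { zero → b-in , v-in }
  where
  b≢v : end₁ T zero ≢ end₂ T zero
  b≢v = loopless T zero
  partner : Σ (Fin _) λ y → y ∈ H e × (∀ (j : Fin 1) → x ≢ y)
  partner = fresh (H e) (λ _ → x) (subst (1 <_) (sym (unif e)) 2≤r)
  y : Fin _
  y = proj₁ partner
  f₁ : Fin 2 → Fin _
  f₁ = extend₂ b≢v (λ ()) x y
  f₁-inj : Injective _≡_ _≡_ f₁
  f₁-inj = extend₂-injective b≢v (λ ()) x y (λ { {()} }) (λ ()) (λ ()) (λ y≡x → proj₂ (proj₂ partner) zero (sym y≡x))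
  b-in : f₁ (end₁ T zero) ∈ H e
  b-in = subst (_∈ H e) (sym (extend₂-b b≢v (λ ()) x y)) x∈e
  v-in : f₁ (end₂ T zero) ∈ H e
  v-in = subst (_∈ H e) (sym (extend₂-v b≢v (λ ()) x y)) (proj₁ (proj₂ partner))

record Placement {s n : ℕ} (b v a : Fin (suc (suc (suc s)))) (Core : Fin n → Set) (x : Fin n)
                 (Y Z : Subset n) : Set where
  field
    place           : Fin (suc (suc (suc s))) → Fin n
    place-injective : Injective _≡_ _≡_ place
    b∈Y             : place b ∈ Y
    v∈Z             : place v ∈ Z
    a↦x             : place a ≡ x
    interior-core   : ∀ {u} → u ≢ b → u ≢ v → Core (place u)

-- Such a placement exists when Core contains x and s + 1 vertices, Y has more than
-- s + 1 points and Z more than s + 2: the interior vertices go injectively into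
-- Core (a to x), then b and v go to points of Y and Z avoiding what is used.
placement : ∀ {s n} {b v a : Fin (suc (suc (suc s)))} (b≢v : b ≢ v) (a≢b : a ≢ b) (a≢v : a ≢ v)
  (Core : Fin n → Set) (h : Fin (suc s) → Fin n) → Injective _≡_ _≡_ h → (∀ j → Core (h j)) →
  ∀ {x} → Core x → (Y Z : Subset n) → suc s < ∣ Y ∣ → suc (suc s) < ∣ Z ∣ →
  Placement b v a Core x Y Z
placement {s} {n} b≢v a≢b a≢v Core h h-inj h-core {x} x-core Y Z Y-large Z-large = record
  { place           = extend₂ b≢v h′ y z
  ; place-injective = extend₂-injective b≢v h′ y z h′-inj (proj₂ (proj₂ y-choice))
                        (proj₂ (proj₂ z-choice) ∘ suc) (λ z≡y → proj₂ (proj₂ z-choice) zero (sym z≡y))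
  ; b∈Y             = subst (_∈ Y) (sym (extend₂-b b≢v h′ y z)) (proj₁ (proj₂ y-choice))
  ; v∈Z             = subst (_∈ Z) (sym (extend₂-v b≢v h′ y z)) (proj₁ (proj₂ z-choice))
  ; a↦x             = trans (extend₂-interior b≢v h′ y z a≢b a≢v) h′-at-a
  ; interior-core   = λ u≢b u≢v → subst Core (sym (extend₂-interior b≢v h′ y z u≢b u≢v))
                                        (h′-core (interior b≢v u≢b u≢v))
  }
  where
  core : Σ (Fin (suc s) → Fin n) λ h′ → Injective _≡_ _≡_ h′ × (∀ j → Core (h′ j)) ×
                                        h′ (interior b≢v a≢b a≢v) ≡ x
  core = retarget Core h h-inj h-core x-core (interior b≢v a≢b a≢v)
  h′ : Fin (suc s) → Fin n
  h′ = proj₁ core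
  h′-inj : Injective _≡_ _≡_ h′
  h′-inj = proj₁ (proj₂ core)
  h′-core : ∀ j → Core (h′ j)
  h′-core = proj₁ (proj₂ (proj₂ core))
  h′-at-a : h′ (interior b≢v a≢b a≢v) ≡ x
  h′-at-a = proj₂ (proj₂ (proj₂ core))
  y-choice : Σ (Fin n) λ y → y ∈ Y × (∀ j → h′ j ≢ y)
  y-choice = fresh Y h′ Y-large
  y : Fin n
  y = proj₁ y-choice
  z-choice : Σ (Fin n) λ z → z ∈ Z × (∀ j → (y Vector.∷ h′) j ≢ z)
  z-choice = fresh Z (y Vector.∷ h′) Z-large
  z : Fin n
  z = proj₁ z-choice

-- The pendant
-- edge of leaf₁ goes to e, the other edges bijectively to g, and the vertices are
-- placed with Y = e and Z = the hyperedge assigned to the pendant edge of leaf₂.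
pendant-copy : ∀ {s n m r} (T : Graph (suc (suc (suc s))) (suc (suc s))) → Connected T →
  (H : MultiHypergraph n m) → Uniform r H → 3 + s ≤ r →
  (g : Fin (suc s) → Fin m) → Injective _≡_ _≡_ g →
  (h : Fin (suc s) → Fin n) → Injective _≡_ _≡_ h → (∀ l → InCore H g (h l)) →
  ∀ {x} → InCore H g x → ∀ {e} → x ∈ H e → (∀ i → g i ≢ e) → BergeCopy T H
pendant-copy {s} {m = m} T conn H unif 3+s≤r g g-inj h h-inj h-core x-core {e} x∈e e-new =
  berge-criterion T H {leaf₁} {leaf₂} {a} {edge₁} {edge₂} pendant₁ pendant₂ only
                  place f₂ place-injective (insertAt-injective g edge₁ e g-inj e-new)
                  (subst (λ E → place leaf₁ ∈ H E) (sym f₂-edge₁) b∈Y)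
                  (subst₂ (λ p E → p ∈ H E) (sym a↦x) (sym f₂-edge₁) x∈e)
                  v∈Z interior-in
  where
  open LeafPair (leaf-pair T conn)
  open OtherEnd (other-end T (proj₁ pendant₁)) renaming (vertex to a; distinct to a≢b)

  -- a = leaf₂ would make leaf₂ incident with edge₁ ≠ edge₂
  a≢v : a ≢ leaf₂
  a≢v a≡v = edges-differ (proj₂ pendant₂ edge₁ (subst (λ u → Incident T u edge₁) a≡v incident))

  large : ∀ e′ → suc (suc s) < ∣ H e′ ∣
  large e′ = subst (3 + s ≤_) (sym (unif e′)) 3+s≤r

  f₂ : Fin (suc (suc s)) → Fin m
  f₂ = insertAt g edge₁ e
  f₂-edge₁ : f₂ edge₁ ≡ e
  f₂-edge₁ = insertAt-lookup g edge₁ e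

  open Placement (placement leaves-differ a≢b a≢v (InCore H g) h h-inj h-core x-core
                            (H e) (H (f₂ edge₂)) (≤-trans (n≤1+n _) (large e)) (large (f₂ edge₂)))

  interior-in : ∀ u i → u ≢ leaf₁ → u ≢ leaf₂ → edge₁ ≢ i → place u ∈ H (f₂ i)
  interior-in u i u≢b u≢v edge₁≢i =
    subst (λ E → place u ∈ H E) (sym (insertAt-punchOut g edge₁ e edge₁≢i))
          (interior-core u≢b u≢v (punchOut edge₁≢i))

outside-edge-copy : ∀ {k t n m r} (T : Graph t k) → IsTree T → 1 ≤ k → k + 1 ≤ r →
  (H : MultiHypergraph n m) → Uniform r H →
  (g : Fin (k ∸ 1) → Fin m) → Injective _≡_ _≡_ g →
  (h : Fin (k ∸ 1) → Fin n) → Injective _≡_ _≡_ h → (∀ l → InCore H g (h l)) →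
  ∀ {x} → InCore H g x → ∀ {e} → x ∈ H e → (∀ i → g i ≢ e) → BergeCopy T H
outside-edge-copy {suc zero} T (refl , _) _ 2≤r H unif _ _ _ _ _ _ x∈e _ =
  single-edge-copy T H unif 2≤r x∈e
outside-edge-copy {suc (suc s)} {r = r} T (refl , conn) _ k+1≤r H unif g g-inj h h-inj h-core =
  pendant-copy T conn H unif (subst (_≤ r) (+-comm (2 + s) 1) k+1≤r) g g-inj h h-inj h-core

claim2 : (n k r : ℕ) → 1 ≤ n → 1 ≤ k → 1 ≤ r → k + 1 ≤ r →
    {t : ℕ} (T : Graph t k) → IsTree T →
    {m : ℕ} (H : MultiHypergraph n m) → Uniform r H → ¬ BergeCopy T H →
    (g : Fin (k ∸ 1) → Fin m) → IsCluster (k ∸ 1) H g →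
    ∀ x → InCore H g x →
      (degree H x ≡ k ∸ 1) × (∀ e → x ∈ H e → Σ (Fin (k ∸ 1)) λ i → g i ≡ e)
claim2 n k r _ 1≤k _ k+1≤r T tree H unif no-copy g (g-inj , h , h-inj , h-core) x x-core =
  degree-exact H g g-inj x-core only-cluster , only-cluster
  where
  only-cluster : ∀ e → x ∈ H e → Σ (Fin (k ∸ 1)) λ i → g i ≡ e
  only-cluster e x∈e with any? (λ i → g i ≟ e)
  ... | yes found = found
  ... | no  absent = contradiction
        (outside-edge-copy T tree 1≤k k+1≤r H unif g g-inj h h-inj h-core x-core x∈e
                           (λ i gi≡e → absent (i , gi≡e)))
        no-copy
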